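{- Let \(m\ge 2\), let \(Q_6=(\mathbb Z_m)^6\), and for \(0\le r\le 6\) let \(p_r=(1,\ldots,1,0,\ldots,0)\in Q_6\) be the vector whose first \(r\) coordinates are \(1\) and whose remaining coordinates are \(0\). For a threshold \(\tau\in\mathbb Z_m\) and \(z=(z_1,\ldots,z_6)\in Q_6\), let \(\rho_\tau(z)=\min\{i:z_i=\tau\}\) if some coordinate of \(z\) equals \(\tau\), and \(\rho_\tau(z)=6\) otherwise. Define maps \(Q_6\to Q_6\) by \(M_\tau^0(z)=z\), \(M_\tau^\Delta(z)=z-p_{\rho_\tau(z)}\), and for \(2\le a\le 6\), \(M_\tau^a(z)=z-p_a\) if \(\rho_\tau(z)<a\) and \(M_\tau^a(z)=z-p_{a-1}\) if \(\rho_\tau(z)\ge a\). For each symbol \(\xi\in\{0,\Delta,2,3,4,5,6\}\) and \(z\in Q_6\), let the label used by \(\xi\) at \(z\) be the index \(\ell_\tau(\xi,z)\in\{0,\ldots,6\}\) given by: \(\ell_\tau(0,z)=0\); \(\ell_\tau(\Delta,z)=\rho_\tau(z)\); and for \(2\le a\le6\), \(\ell_\tau(a,z)=a\) if \(\rho_\tau(z)<a\) and \(\ell_\tau(a,z)=a-1\) otherwise (so \(M_\tau^\xi(z)=z-p_{\ell_\tau(\xi,z)}\)). Then for every \(\tau\in\mathbb Z_m\) and every \(z\in Q_6\), the map \(\xi\mapsto \ell_\tau(\xi,z)\) is a bijection from \(\{0,\Delta,2,3,4,5,6\}\) onto \(\{0,1,\ldots,6\}\), and each of the seven maps \(M_\tau^0,M_\tau^\Delta,M_\tau^2,\ldots,M_\tau^6\)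 is a bijection of \(Q_6\).
   Context: Here \(\Delta\) is a formal symbol distinct from the integers; the symbol set is \(\Sigma_6=\{0,\Delta,2,3,4,5,6\}\). -}

module Defs where

open import Data.Nat using (ℕ; zero; suc; _+_; _∸_; _<ᵇ_; NonZero)
open import Data.Nat.DivMod using (_mod_)
open import Data.Fin using (Fin; toℕ; _≟_; #_)
open import Data.Bool using (Bool; true; false; if_then_else_)
open import Relation.Nullary using (does)
open import Data.Vec using (Vec; tabulate; zipWith; lookup)

-- ℤ_m is represented by Fin m (the statement assumes m ≥ 2; NonZero m is needed for mod).
-- Q₆ = (ℤ_m)^6 as vectors Vec (Fin m) 6; index j : Fin 6 is the paper's coordinate j+1.
Q6 : (m : ℕ) → Set
Q6 m = Vec (Fin m) 6

subZ : {m : ℕ} .{{_ : NonZero m}} → Fin m → Fin m → Fin m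
subZ {m} x y = (toℕ x + (m ∸ toℕ y)) mod m

oneZ : (m : ℕ) .{{_ : NonZero m}} → Fin m
oneZ m = 1 mod m

zeroZ : (m : ℕ) .{{_ : NonZero m}} → Fin m
zeroZ m = 0 mod m

p : (m : ℕ) .{{_ : NonZero m}} → ℕ → Q6 m
p m r = tabulate (λ j → if toℕ j <ᵇ r then oneZ m else zeroZ m)

subQ : {m : ℕ} .{{_ : NonZero m}} → Q6 m → Q6 m → Q6 m
subQ z w = zipWith subZ z w

rho : {m : ℕ} → Fin m → Q6 m → ℕ
rho τ z =
  if does (lookup z (# 0) ≟ τ) then 1 else
  if does (lookup z (# 1) ≟ τ) then 2 else
  if does (lookup z (# 2) ≟ τ) then 3 else
  if does (lookup z (# 3) ≟ τ) then 4 else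
  if does (lookup z (# 4) ≟ τ) then 5 else
  if does (lookup z (# 5) ≟ τ) then 6 else 6

data Sym : Set where
  s0 sΔ s2 s3 s4 s5 s6 : Sym

labelA : ℕ → ℕ → ℕ
labelA a r = if r <ᵇ a then a else a ∸ 1

label : {m : ℕ} → Fin m → Sym → Q6 m → ℕ
label τ s0 z = 0
label τ sΔ z = rho τ z
label τ s2 z = labelA 2 (rho τ z)
label τ s3 z = labelA 3 (rho τ z)
label τ s4 z = labelA 4 (rho τ z)
label τ s5 z = labelA 5 (rho τ z)
label τ s6 z = labelA 6 (rho τ z)

M : {m : ℕ} .{{_ : NonZero m}} → Fin m → Sym → Q6 m → Q6 m
M τ s0 z = z
M {m} τ sΔ z = subQ z (p m (rho τ z))
M {m} τ s2 z = if rho τ z <ᵇ 2 then subQ z (p m 2) else subQ z (p m 1)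
M {m} τ s3 z = if rho τ z <ᵇ 3 then subQ z (p m 3) else subQ z (p m 2)
M {m} τ s4 z = if rho τ z <ᵇ 4 then subQ z (p m 4) else subQ z (p m 3)
M {m} τ s5 z = if rho τ z <ᵇ 5 then subQ z (p m 5) else subQ z (p m 4)
M {m} τ s6 z = if rho τ z <ᵇ 6 then subQ z (p m 6) else subQ z (p m 5)

{-# OPTIONS --safe #-}
-- Every M_τ^ξ subtracts 1 from the first ℓ = ℓ_τ(ξ, z) coordinates. Since subtracting 1 is
-- injective, among those coordinates the entries equal to τ are exactly the ones that become
-- τ - 1, so ρ_{τ-1}(M_τ^ξ z) and ρ_τ(z) agree after truncation at ℓ + 1. The label ℓ_τ(ξ, z)
-- depends on ρ_τ(z) only through that truncation, hence ℓ_{τ-1}(ξ, M_τ^ξ z) = ℓ, and adding 1 to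
-- the first ℓ_{τ-1}(ξ, w) coordinates of w inverts M_τ^ξ. That ξ ↦ ℓ_τ(ξ, z) is a bijection onto
-- {0, …, 6} is a finite check over the six possible values of ρ_τ(z).
module Submission where

open import Defs
open import Data.Nat using (ℕ; _≤_; _<_; NonZero)
open import Data.Fin using (Fin)
open import Data.Product using (_×_; ∃)
open import Relation.Binary.PropositionalEquality using (_≡_)
open import Function.Definitions using (Bijective)

open import Data.Bool using (true; false; if_then_else_)
open import Data.Fin as Fin using (toℕ)
open import Data.Fin.Properties using (toℕ-fromℕ<; toℕ-injective; toℕ<n)
open import Data.Nat using (zero; suc; _+_; _∸_; _⊓_; _<ᵇ_; _%_; z≤n; s≤s; compare; less; equal; greater; >-nonZero⁻¹)
open import Data.Nat.DivMod using (_mod_; m%n<n; %-distribˡ-+; m%n%n≡m%n; [m+n]%n≡m%n; m<n⇒m%n≡m)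
open import Data.Nat.Properties
  using (≤-refl; ≤-trans; <⇒≤; <⇒≱; ≮⇒≥; m≤m+n; m⊓n≤m; m∸n≤m; <ᵇ-reflects-<; m≥n⇒m⊓n≡n; suc-injective; +-assoc; m+[n∸m]≡n; m∸n+n≡m)
open import Data.Product using (_,_; proj₁; proj₂)
open import Data.Vec using (Vec; []; _∷_; zipWith; tabulate)
open import Function using (_∘_; id)
open import Level using (Level)
open import Function.Consequences.Propositional
  using (inverseᵇ⇒bijective; inverseʳ⇒injective; strictlyInverseˡ⇒inverseˡ; strictlyInverseʳ⇒inverseʳ)
open import Function.Definitions using (Injective)
open import Relation.Binary.Definitions using (DecidableEquality)
open import Relation.Binary.PropositionalEquality
  using (refl; sym; trans; cong; cong₂; subst; _≗_; module ≡-Reasoning)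
open import Relation.Nullary using (does; yes; no; contradiction)
open import Relation.Nullary.Reflects using (ofʸ; ofⁿ)

private
  variable
    a : Level
    A : Set a
    n : ℕ

mapPrefix : (A → A) → ℕ → Vec A n → Vec A n
mapPrefix f zero    xs       = xs
mapPrefix f (suc k) []       = []
mapPrefix f (suc k) (x ∷ xs) = f x ∷ mapPrefix f k xs

mapPrefix-inverse : {f g : A → A} → g ∘ f ≗ id → ∀ k (xs : Vec A n) →
                    mapPrefix g k (mapPrefix f k xs) ≡ xs
mapPrefix-inverse g∘f zero    xs       = refl
mapPrefix-inverse g∘f (suc k) []       = refl
mapPrefix-inverse g∘f (suc k) (x ∷ xs) = cong₂ _∷_ (g∘f x) (mapPrefix-inverse g∘f k xs)

module _ (_≟_ : DecidableEquality A) where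

  firstIndexOf : A → Vec A n → ℕ
  firstIndexOf τ []       = 0
  firstIndexOf τ (x ∷ xs) = if does (x ≟ τ) then 1 else suc (firstIndexOf τ xs)

  firstIndexOf-∷-≥1 : ∀ τ x (xs : Vec A n) → 1 ≤ firstIndexOf τ (x ∷ xs)
  firstIndexOf-∷-≥1 τ x xs with does (x ≟ τ)
  ... | true  = s≤s z≤n
  ... | false = s≤s z≤n

  firstIndexOf-≤-length : ∀ τ (xs : Vec A n) → firstIndexOf τ xs ≤ n
  firstIndexOf-≤-length τ []       = z≤n
  firstIndexOf-≤-length τ (x ∷ xs) with does (x ≟ τ)
  ... | true  = s≤s z≤n
  ... | false = s≤s (firstIndexOf-≤-length τ xs)

  firstIndexOf-mapPrefix : {f : A → A} → Injective _≡_ _≡_ f → ∀ τ k (xs : Vec A n) →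
    firstIndexOf (f τ) (mapPrefix f k xs) ⊓ suc k ≡ firstIndexOf τ xs ⊓ suc k
  firstIndexOf-mapPrefix f-inj τ zero []       = refl
  firstIndexOf-mapPrefix f-inj τ zero (x ∷ xs) =
    trans (m≥n⇒m⊓n≡n (firstIndexOf-∷-≥1 _ x xs)) (sym (m≥n⇒m⊓n≡n (firstIndexOf-∷-≥1 τ x xs)))
  firstIndexOf-mapPrefix f-inj τ (suc k) [] = refl
  firstIndexOf-mapPrefix {f = f} f-inj τ (suc k) (x ∷ xs) with x ≟ τ | f x ≟ f τ
  ... | yes _   | yes _     = refl
  ... | no _    | no _      = cong suc (firstIndexOf-mapPrefix f-inj τ k xs)
  ... | yes x≡τ | no fx≢fτ  = contradiction (cong f x≡τ) fx≢fτ
  ... | no x≢τ  | yes fx≡fτ = contradiction (f-inj fx≡fτ) x≢τ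

⊓-suc-≤ : ∀ {r r′} k → r′ ⊓ suc k ≡ r ⊓ suc k → r ≤ k → r′ ≡ r
⊓-suc-≤ {zero}  {zero}   _       _ _           = refl
⊓-suc-≤ {zero}  {suc _}  _       () _
⊓-suc-≤ {suc _} {zero}   (suc _) () _
⊓-suc-≤ {suc _} {suc _}  (suc k) h (s≤s r≤k) = cong suc (⊓-suc-≤ k (suc-injective h) r≤k)

⊓-suc-> : ∀ {r r′} k → r′ ⊓ suc k ≡ r ⊓ suc k → k < r → k < r′
⊓-suc-> {r′ = r′} k h k<r = subst (_≤ r′) (trans h (m≥n⇒m⊓n≡n k<r)) (m⊓n≤m r′ (suc k))

labelOf : Sym → ℕ → ℕ
labelOf s0 r = 0
labelOf sΔ r = r
labelOf s2 r = labelA 2 r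
labelOf s3 r = labelA 3 r
labelOf s4 r = labelA 4 r
labelOf s5 r = labelA 5 r
labelOf s6 r = labelA 6 r

labelA-< : ∀ {a r} → r < a → labelA a r ≡ a
labelA-< {a} {r} r<a with r <ᵇ a | <ᵇ-reflects-< r a
... | true  | _        = refl
... | false | ofⁿ r≮a = contradiction r<a r≮a

labelA-≥ : ∀ {a r} → a ≤ r → labelA a r ≡ a ∸ 1
labelA-≥ {a} {r} a≤r with r <ᵇ a | <ᵇ-reflects-< r a
... | true  | ofʸ r<a = contradiction a≤r (<⇒≱ r<a)
... | false | _       = refl

labelA-≤ : ∀ a r → labelA a r ≤ a
labelA-≤ a r with r <ᵇ a
... | true  = ≤-refl
... | false = m∸n≤m a 1

labelA-⊓ : ∀ a {r r′} → r′ ⊓ suc (labelA a r) ≡ r ⊓ suc (labelA a r) → labelA a r′ ≡ labelA a r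
labelA-⊓ zero          _ = refl
labelA-⊓ (suc b) {r} {r′} h with r <ᵇ suc b | <ᵇ-reflects-< r (suc b)
... | true  | ofʸ r<a  = labelA-< (subst (_< suc b) (sym (⊓-suc-≤ (suc b) h (<⇒≤ r<a))) r<a)
... | false | ofⁿ r≮a = labelA-≥ (⊓-suc-> b h (≮⇒≥ r≮a))

labelOf-⊓ : ∀ ξ {r r′} → r′ ⊓ suc (labelOf ξ r) ≡ r ⊓ suc (labelOf ξ r) → labelOf ξ r′ ≡ labelOf ξ r
labelOf-⊓ s0     _ = refl
labelOf-⊓ sΔ {r} h = ⊓-suc-≤ r h ≤-refl
labelOf-⊓ s2       = labelA-⊓ 2
labelOf-⊓ s3       = labelA-⊓ 3
labelOf-⊓ s4       = labelA-⊓ 4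
labelOf-⊓ s5       = labelA-⊓ 5
labelOf-⊓ s6       = labelA-⊓ 6

labelOf-≤ : ∀ ξ {r} → r ≤ 6 → labelOf ξ r ≤ 6
labelOf-≤ s0     _   = z≤n
labelOf-≤ sΔ     r≤6 = r≤6
labelOf-≤ s2 {r} _   = ≤-trans (labelA-≤ 2 r) (m≤m+n 2 4)
labelOf-≤ s3 {r} _   = ≤-trans (labelA-≤ 3 r) (m≤m+n 3 3)
labelOf-≤ s4 {r} _   = ≤-trans (labelA-≤ 4 r) (m≤m+n 4 2)
labelOf-≤ s5 {r} _   = ≤-trans (labelA-≤ 5 r) (m≤m+n 5 1)
labelOf-≤ s6 {r} _   = labelA-≤ 6 r

numeral : ℕ → Sym
numeral 2 = s2
numeral 3 = s3
numeral 4 = s4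
numeral 5 = s5
numeral 6 = s6
numeral _ = s0

symbolOf : ℕ → ℕ → Sym
symbolOf r zero = s0
symbolOf r (suc k) with compare (suc k) r
... | less    _ _ = numeral (suc (suc k))
... | equal   _   = sΔ
... | greater _ _ = numeral (suc k)

Sym-elim : {P : Sym → Set} → P s0 → P sΔ → P s2 → P s3 → P s4 → P s5 → P s6 → ∀ ξ → P ξ
Sym-elim p0 pΔ p2 p3 p4 p5 p6 s0 = p0
Sym-elim p0 pΔ p2 p3 p4 p5 p6 sΔ = pΔ
Sym-elim p0 pΔ p2 p3 p4 p5 p6 s2 = p2
Sym-elim p0 pΔ p2 p3 p4 p5 p6 s3 = p3
Sym-elim p0 pΔ p2 p3 p4 p5 p6 s4 = p4
Sym-elim p0 pΔ p2 p3 p4 p5 p6 s5 = p5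
Sym-elim p0 pΔ p2 p3 p4 p5 p6 s6 = p6

<7-elim : {P : ℕ → Set} → P 0 → P 1 → P 2 → P 3 → P 4 → P 5 → P 6 → ∀ k → k < 7 → P k
<7-elim p0 p1 p2 p3 p4 p5 p6 0 _ = p0
<7-elim p0 p1 p2 p3 p4 p5 p6 1 _ = p1
<7-elim p0 p1 p2 p3 p4 p5 p6 2 _ = p2
<7-elim p0 p1 p2 p3 p4 p5 p6 3 _ = p3
<7-elim p0 p1 p2 p3 p4 p5 p6 4 _ = p4
<7-elim p0 p1 p2 p3 p4 p5 p6 5 _ = p5
<7-elim p0 p1 p2 p3 p4 p5 p6 6 _ = p6
<7-elim p0 p1 p2 p3 p4 p5 p6 (suc (suc (suc (suc (suc (suc (suc _))))))) (s≤s (s≤s (s≤s (s≤s (s≤s (s≤s (s≤s ())))))))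

symbolOf-inverse : ∀ {r} → 1 ≤ r → r ≤ 6 →
  (∀ ξ → symbolOf r (labelOf ξ r) ≡ ξ) × (∀ k → k < 7 → labelOf (symbolOf r k) r ≡ k)
symbolOf-inverse {1} _ _ = Sym-elim refl refl refl refl refl refl refl , <7-elim refl refl refl refl refl refl refl
symbolOf-inverse {2} _ _ = Sym-elim refl refl refl refl refl refl refl , <7-elim refl refl refl refl refl refl refl
symbolOf-inverse {3} _ _ = Sym-elim refl refl refl refl refl refl refl , <7-elim refl refl refl refl refl refl refl
symbolOf-inverse {4} _ _ = Sym-elim refl refl refl refl refl refl refl , <7-elim refl refl refl refl refl refl refl
symbolOf-inverse {5} _ _ = Sym-elim refl refl refl refl refl refl refl , <7-elim refl refl refl refl refl refl refl
symbolOf-inverse {6} _ _ = Sym-elim refl refl refl refl refl refl refl , <7-elim refl refl refl refl refl refl refl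
symbolOf-inverse {suc (suc (suc (suc (suc (suc (suc _))))))} _ (s≤s (s≤s (s≤s (s≤s (s≤s (s≤s ()))))))

label≡labelOf : ∀ {m} (τ : Fin m) ξ z → label τ ξ z ≡ labelOf ξ (rho τ z)
label≡labelOf τ s0 z = refl
label≡labelOf τ sΔ z = refl
label≡labelOf τ s2 z = refl
label≡labelOf τ s3 z = refl
label≡labelOf τ s4 z = refl
label≡labelOf τ s5 z = refl
label≡labelOf τ s6 z = refl

rho≡firstIndexOf : ∀ {m} (τ : Fin m) z → rho τ z ≡ firstIndexOf Fin._≟_ τ z
rho≡firstIndexOf τ (z₁ ∷ z₂ ∷ z₃ ∷ z₄ ∷ z₅ ∷ z₆ ∷ [])
  with does (z₁ Fin.≟ τ) | does (z₂ Fin.≟ τ) | does (z₃ Fin.≟ τ)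
     | does (z₄ Fin.≟ τ) | does (z₅ Fin.≟ τ) | does (z₆ Fin.≟ τ)
... | true  | _     | _     | _     | _     | _     = refl
... | false | true  | _     | _     | _     | _     = refl
... | false | false | true  | _     | _     | _     = refl
... | false | false | false | true  | _     | _     = refl
... | false | false | false | false | true  | _     = refl
... | false | false | false | false | false | true  = refl
... | false | false | false | false | false | false = refl

rho-range : ∀ {m} (τ : Fin m) z → 1 ≤ rho τ z × rho τ z ≤ 6
rho-range τ z@(z₁ ∷ zs) rewrite rho≡firstIndexOf τ z =
  firstIndexOf-∷-≥1 Fin._≟_ τ z₁ zs , firstIndexOf-≤-length Fin._≟_ τ z

rho-mapPrefix : ∀ {m} {f : Fin m → Fin m} → Injective _≡_ _≡_ f → ∀ τ k z →
  rho (f τ) (mapPrefix f k z) ⊓ suc k ≡ rho τ z ⊓ suc k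
rho-mapPrefix {f = f} f-inj τ k z
  rewrite rho≡firstIndexOf (f τ) (mapPrefix f k z) | rho≡firstIndexOf τ z = firstIndexOf-mapPrefix Fin._≟_ f-inj τ k z

mapLabelPrefix : ∀ {m} → (Fin m → Fin m) → Fin m → Sym → Q6 m → Q6 m
mapLabelPrefix f τ ξ z = mapPrefix f (labelOf ξ (rho τ z)) z

mapLabelPrefix-inverse : ∀ {m} {f g : Fin m → Fin m} → g ∘ f ≗ id → ∀ τ ξ z →
  mapLabelPrefix g (f τ) ξ (mapLabelPrefix f τ ξ z) ≡ z
mapLabelPrefix-inverse {f = f} {g} g∘f τ ξ z = begin
  mapPrefix g (labelOf ξ (rho (f τ) (mapPrefix f ℓ z))) (mapPrefix f ℓ z)
    ≡⟨ cong (λ k → mapPrefix g k (mapPrefix f ℓ z)) (labelOf-⊓ ξ (rho-mapPrefix f-inj τ ℓ z)) ⟩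
  mapPrefix g ℓ (mapPrefix f ℓ z)
    ≡⟨ mapPrefix-inverse g∘f ℓ z ⟩
  z ∎
  where
  open ≡-Reasoning
  ℓ : ℕ
  ℓ = labelOf ξ (rho τ z)
  f-inj : Injective _≡_ _≡_ f
  f-inj = inverseʳ⇒injective f (strictlyInverseʳ⇒inverseʳ {f⁻¹ = g} f g∘f)

label-bijective : ∀ {m} (τ : Fin m) (z : Q6 m) →
  ((ξ : Sym) → label τ ξ z < 7)
  × ((ξ η : Sym) → label τ ξ z ≡ label τ η z → ξ ≡ η)
  × ((k : ℕ) → k < 7 → ∃ λ ξ → label τ ξ z ≡ k)
label-bijective τ z = bounded , injective , surjective
  where
  r : ℕ
  r = rho τ z
  1≤r : 1 ≤ r
  1≤r = proj₁ (rho-range τ z)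
  r≤6 : r ≤ 6
  r≤6 = proj₂ (rho-range τ z)

  symbolOf-label : ∀ ξ → symbolOf r (label τ ξ z) ≡ ξ
  symbolOf-label ξ = trans (cong (symbolOf r) (label≡labelOf τ ξ z)) (proj₁ (symbolOf-inverse 1≤r r≤6) ξ)

  bounded : ∀ ξ → label τ ξ z < 7
  bounded ξ = subst (_< 7) (sym (label≡labelOf τ ξ z)) (s≤s (labelOf-≤ ξ r≤6))

  injective : ∀ ξ η → label τ ξ z ≡ label τ η z → ξ ≡ η
  injective ξ η e = trans (sym (symbolOf-label ξ)) (trans (cong (symbolOf r) e) (symbolOf-label η))

  surjective : ∀ k → k < 7 → ∃ λ ξ → label τ ξ z ≡ k
  surjective k k<7 = symbolOf r k , trans (label≡labelOf τ (symbolOf r k) z) (proj₂ (symbolOf-inverse 1≤r r≤6) k k<7)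

module _ {m : ℕ} .{{_ : NonZero m}} where

  addZ : Fin m → Fin m → Fin m
  addZ x y = (toℕ x + toℕ y) mod m

  private
    toℕ-mod : ∀ n → toℕ (n mod m) ≡ n % m
    toℕ-mod n = toℕ-fromℕ< (m%n<n n m)

    toℕ+m%m : (x : Fin m) → (toℕ x + m) % m ≡ toℕ x
    toℕ+m%m x = trans ([m+n]%n≡m%n (toℕ x) m) (m<n⇒m%n≡m (toℕ<n x))

    [[x+a]%m+b]%m : ∀ (x : Fin m) {a b} → a + b ≡ m → ((toℕ x + a) % m + b) % m ≡ toℕ x
    [[x+a]%m+b]%m x {a} {b} a+b≡m = begin
      ((toℕ x + a) % m + b) % m           ≡⟨ %-distribˡ-+ ((toℕ x + a) % m) b m ⟩
      ((toℕ x + a) % m % m + b % m) % m   ≡⟨ cong (λ t → (t + b % m) % m) (m%n%n≡m%n (toℕ x + a) m) ⟩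
      ((toℕ x + a) % m + b % m) % m       ≡⟨ %-distribˡ-+ (toℕ x + a) b m ⟨
      (toℕ x + a + b) % m                 ≡⟨ cong (_% m) (trans (+-assoc (toℕ x) a b) (cong (toℕ x +_) a+b≡m)) ⟩
      (toℕ x + m) % m                     ≡⟨ toℕ+m%m x ⟩
      toℕ x                               ∎
      where open ≡-Reasoning

  subZ-addZ : ∀ x y → subZ (addZ x y) y ≡ x
  subZ-addZ x y = toℕ-injective (begin
    toℕ (subZ (addZ x y) y)                            ≡⟨ toℕ-mod _ ⟩
    (toℕ (addZ x y) + (m ∸ toℕ y)) % m                 ≡⟨ cong (λ t → (t + (m ∸ toℕ y)) % m) (toℕ-mod _) ⟩
    ((toℕ x + toℕ y) % m + (m ∸ toℕ y)) % m           ≡⟨ [[x+a]%m+b]%m x (m+[n∸m]≡n (<⇒≤ (toℕ<n y))) ⟩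
    toℕ x                                              ∎)
    where open ≡-Reasoning

  addZ-subZ : ∀ x y → addZ (subZ x y) y ≡ x
  addZ-subZ x y = toℕ-injective (begin
    toℕ (addZ (subZ x y) y)                            ≡⟨ toℕ-mod _ ⟩
    (toℕ (subZ x y) + toℕ y) % m                       ≡⟨ cong (λ t → (t + toℕ y) % m) (toℕ-mod _) ⟩
    ((toℕ x + (m ∸ toℕ y)) % m + toℕ y) % m           ≡⟨ [[x+a]%m+b]%m x (m∸n+n≡m (<⇒≤ (toℕ<n y))) ⟩
    toℕ x                                              ∎)
    where open ≡-Reasoning

  subZ-zeroZ : ∀ x → subZ x (zeroZ m) ≡ x
  subZ-zeroZ x = toℕ-injective (begin
    toℕ (subZ x (zeroZ m))                  ≡⟨ toℕ-mod _ ⟩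
    (toℕ x + (m ∸ toℕ (zeroZ m))) % m       ≡⟨ cong (λ t → (toℕ x + (m ∸ t)) % m) toℕ-zeroZ ⟩
    (toℕ x + m) % m                         ≡⟨ toℕ+m%m x ⟩
    toℕ x                                   ∎)
    where
    open ≡-Reasoning
    toℕ-zeroZ : toℕ (zeroZ m) ≡ 0
    toℕ-zeroZ = trans (toℕ-mod 0) (m<n⇒m%n≡m (>-nonZero⁻¹ m))

  decZ incZ : Fin m → Fin m
  decZ x = subZ x (oneZ m)
  incZ x = addZ x (oneZ m)

  subQ-p : ∀ k z → subQ z (p m k) ≡ mapPrefix decZ k z
  subQ-p = zipWith-subZ-indicator
    where
    -- p m k, generalised to an arbitrary length n so that the induction goes through
    zipWith-subZ-indicator : ∀ {n} k (z : Vec (Fin m) n) →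
      zipWith subZ z (tabulate (λ j → if toℕ j <ᵇ k then oneZ m else zeroZ m)) ≡ mapPrefix decZ k z
    zipWith-subZ-indicator zero    []      = refl
    zipWith-subZ-indicator zero    (x ∷ z) = cong₂ _∷_ (subZ-zeroZ x) (zipWith-subZ-indicator zero z)
    zipWith-subZ-indicator (suc k) []      = refl
    zipWith-subZ-indicator (suc k) (x ∷ z) = cong (decZ x ∷_) (zipWith-subZ-indicator k z)

  subQ-p-if : ∀ a b z →
    (if b then subQ z (p m a) else subQ z (p m (a ∸ 1))) ≡ mapPrefix decZ (if b then a else a ∸ 1) z
  subQ-p-if a true  z = subQ-p a z
  subQ-p-if a false z = subQ-p (a ∸ 1) z

  M≡mapLabelPrefix : ∀ τ ξ z → M τ ξ z ≡ mapLabelPrefix decZ τ ξ z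
  M≡mapLabelPrefix τ s0 z = refl
  M≡mapLabelPrefix τ sΔ z = subQ-p (rho τ z) z
  M≡mapLabelPrefix τ s2 z = subQ-p-if 2 (rho τ z <ᵇ 2) z
  M≡mapLabelPrefix τ s3 z = subQ-p-if 3 (rho τ z <ᵇ 3) z
  M≡mapLabelPrefix τ s4 z = subQ-p-if 4 (rho τ z <ᵇ 4) z
  M≡mapLabelPrefix τ s5 z = subQ-p-if 5 (rho τ z <ᵇ 5) z
  M≡mapLabelPrefix τ s6 z = subQ-p-if 6 (rho τ z <ᵇ 6) z

  M-bijective : ∀ τ ξ → Bijective _≡_ _≡_ (M τ ξ)
  M-bijective τ ξ =
    inverseᵇ⇒bijective (strictlyInverseˡ⇒inverseˡ (M τ ξ) M∘N , strictlyInverseʳ⇒inverseʳ (M τ ξ) N∘M)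
    where
    open ≡-Reasoning
    N : Q6 m → Q6 m
    N = mapLabelPrefix incZ (decZ τ) ξ

    N∘M : ∀ z → N (M τ ξ z) ≡ z
    N∘M z = trans (cong N (M≡mapLabelPrefix τ ξ z)) (mapLabelPrefix-inverse (λ x → addZ-subZ x (oneZ m)) τ ξ z)

    M∘N : ∀ w → M τ ξ (N w) ≡ w
    M∘N w = begin
      M τ ξ (N w)                                  ≡⟨ M≡mapLabelPrefix τ ξ (N w) ⟩
      mapLabelPrefix decZ τ ξ (N w)                ≡⟨ cong (λ σ → mapLabelPrefix decZ σ ξ (N w)) (addZ-subZ τ (oneZ m)) ⟨
      mapLabelPrefix decZ (incZ (decZ τ)) ξ (N w)  ≡⟨ mapLabelPrefix-inverse (λ x → subZ-addZ x (oneZ m)) (decZ τ) ξ w ⟩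
      w                                            ∎

lemma3p1 : (m : ℕ) .{{_ : NonZero m}} → 2 ≤ m → (τ : Fin m) →
    ((z : Q6 m) →
      ((ξ : Sym) → label τ ξ z < 7)
      × ((ξ η : Sym) → label τ ξ z ≡ label τ η z → ξ ≡ η)
      × ((k : ℕ) → k < 7 → ∃ λ ξ → label τ ξ z ≡ k))
    × ((ξ : Sym) → Bijective _≡_ _≡_ (M τ ξ))
lemma3p1 m _ τ = label-bijective τ , M-bijective τ
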